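{- Let $\Gamma$ be a typing context, $s$ a store term, $V$ a value, $\ell$ a location and $\sigma$ a store type. (a) If $\ell\notin\mathrm{dom}(\sigma)$, then $\Gamma\vdash s:\sigma$ if and only if $\Gamma\vdash\mathrm{upd}_\ell(V,s):\sigma$. (b) If $\Gamma\vdash\mathrm{upd}_\ell(V,s):\sigma$ and $\sigma\le_S\langle\ell:\delta\rangle$ for a value type $\delta$ with $\langle\ell:\delta\rangle$ not equivalent to $\omega_S$, then $\Gamma\vdash V:\delta$.
   Context: Fix a countably infinite set $\mathbf{L}$ of locations. Values $V,W ::= x\mid\lambda x.M$ where $M$ ranges over computations $[V]\mid M\star V\mid\mathit{get}_\ell(\lambda x.M)\mid\mathit{set}_\ell(V,M)$. Store terms $s ::= \mathrm{emp} \mid \mathrm{upd}_\ell(u,s)$, lookup terms $u ::= V \mid \mathrm{lkp}_\ell(s)$. Types. Value types $\delta ::= \delta\to\tau \mid \delta\wedge\delta \mid \omega_D$; store types $\sigma ::= \langle \ell:\delta\rangle \mid \sigma\wedge\sigma \mid \omega_S$; computation types $\kappa ::= \delta\times\sigma \mid \kappa\wedge\kappa\mid\omega_C$; configuration types $\tau ::= \sigma\to\kappa \mid \tau\wedge\tau \mid \omega_T$. For each sort $A$, $\le_A$ is the least preorder with $\varphi\le\omega_A$, $\varphi\wedge\psi\le\varphi$, $\varphi\wedge\psi\le\psi$, $\varphi\le\varphi\wedge\varphi$, monotonicity of $\wedge$, and: $\omega_D\le\omega_D\to\omega_T$; $(\delta\to\tau)\wedge(\delta\to\tau')\le\delta\to(\tau\wedge\tau')$;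 $\langle\ell:\delta\rangle\wedge\langle\ell:\delta'\rangle\le\langle\ell:\delta\wedge\delta'\rangle$; $\omega_C\le\omega_D\times\omega_S$; $(\delta\times\sigma)\wedge(\delta'\times\sigma')\le(\delta\wedge\delta')\times(\sigma\wedge\sigma')$; $\omega_T\le\omega_S\to\omega_C$; $(\sigma\to\kappa)\wedge(\sigma\to\kappa')\le\sigma\to(\kappa\wedge\kappa')$; arrows contravariant/covariant; $\times$, $\langle\ell:\cdot\rangle$ covariant. Two types are equivalent if each is $\le$ the other. $\mathrm{dom}(\langle\ell:\delta\rangle)=\{\ell\}$, $\mathrm{dom}(\sigma\wedge\sigma')=\mathrm{dom}(\sigma)\cup\mathrm{dom}(\sigma')$, $\mathrm{dom}(\omega_S)=\emptyset$. Type system. Contexts $\Gamma$ map finitely many variables to value types ($\Gamma,x:\delta$ requires $x\notin\mathrm{dom}(\Gamma)$). Rules: $\Gamma\vdash Q:\omega_A$ for $Q$ of the corresponding sort; intersection introduction; subsumption; $\Gamma,x:\delta\vdash x:\delta$; $\Gamma,x:\delta\vdash M:\tau\Rightarrow\Gamma\vdash\lambda x.M:\delta\to\tau$; $\Gamma\vdash V:\delta\Rightarrow\Gamma\vdash[V]:\sigma\to\delta\times\sigma$; $\Gamma\vdash M:\sigma\to\delta'\times\sigma'$, $\Gamma\vdash V:\delta'\to\sigma'\to\delta''\times\sigma''\Rightarrow\Gamma\vdash M\star V:\sigma\to\delta''\times\sigma''$; $\Gamma,x:\delta\vdash M:\sigma\to\kappa\Rightarrow\Gamma\vdash\mathit{get}_\ell(\lambda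 x.M):(\langle\ell:\delta\rangle\wedge\sigma)\to\kappa$; $\Gamma\vdash V:\delta$, $\Gamma\vdash M:(\langle\ell:\delta\rangle\wedge\sigma)\to\kappa$, $\ell\notin\mathrm{dom}(\sigma)\Rightarrow\Gamma\vdash\mathit{set}_\ell(V,M):\sigma\to\kappa$; $\Gamma\vdash V:\delta\Rightarrow\Gamma\vdash\mathrm{upd}_\ell(V,s):\langle\ell:\delta\rangle$; $\Gamma\vdash s:\langle\ell':\delta\rangle$, $\ell\ne\ell'\Rightarrow\Gamma\vdash\mathrm{upd}_\ell(V,s):\langle\ell':\delta\rangle$; $\Gamma\vdash s:\langle\ell:\delta\rangle\Rightarrow\Gamma\vdash\mathrm{lkp}_\ell(s):\delta$. -}

module Defs where

open import Data.Nat using (ℕ; zero; suc)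
open import Data.List using (List; []; _∷_)
open import Data.Product using (_×_)
open import Relation.Binary.PropositionalEquality using (_≡_)
open import Relation.Nullary using (¬_)

Loc : Set
Loc = ℕ

-- Syntax (variables as de Bruijn indices).

data Val : Set
data Comp : Set

data Val where
  var : ℕ → Val
  lam : Comp → Val

data Comp where
  ret  : Val → Comp
  _⋆_  : Comp → Val → Comp
  get  : Loc → Comp → Comp   -- get_ℓ(λx.M), the body M binds index 0
  set  : Loc → Val → Comp → Comp

data Store : Set
data Lkp : Set

data Store where
  emp : Store
  upd : Loc → Lkp → Store → Store

data Lkp where
  val : Val → Lkp
  lkp : Loc → Store → Lkp

data VTy : Set
data STy : Set
data KTy : Set
data TTy : Set

infixr 5 _⟶_ _⇒_
infixl 6 _∧D_ _∧S_ _∧C_ _∧T_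

data VTy where
  _⟶_ : VTy → TTy → VTy
  _∧D_ : VTy → VTy → VTy
  ωD : VTy

data STy where
  ⟨_∶_⟩ : Loc → VTy → STy
  _∧S_ : STy → STy → STy
  ωS : STy

data KTy where
  _⊗_ : VTy → STy → KTy
  _∧C_ : KTy → KTy → KTy
  ωC : KTy

data TTy where
  _⇒_ : STy → KTy → TTy
  _∧T_ : TTy → TTy → TTy
  ωT : TTy

infix 4 _≤D_ _≤S_ _≤C_ _≤T_

data _≤D_ : VTy → VTy → Set
data _≤S_ : STy → STy → Set
data _≤C_ : KTy → KTy → Set
data _≤T_ : TTy → TTy → Set

data _≤D_ where
  reflD  : ∀ {φ} → φ ≤D φ
  transD : ∀ {φ ψ χ} → φ ≤D ψ → ψ ≤D χ → φ ≤D χ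
  topD   : ∀ {φ} → φ ≤D ωD
  ∧lD    : ∀ {φ ψ} → φ ∧D ψ ≤D φ
  ∧rD    : ∀ {φ ψ} → φ ∧D ψ ≤D ψ
  dupD   : ∀ {φ} → φ ≤D φ ∧D φ
  monD   : ∀ {φ φ' ψ ψ'} → φ ≤D φ' → ψ ≤D ψ' → φ ∧D ψ ≤D φ' ∧D ψ'
  ωarr   : ωD ≤D ωD ⟶ ωT
  arr∧   : ∀ {δ τ τ'} → (δ ⟶ τ) ∧D (δ ⟶ τ') ≤D δ ⟶ (τ ∧T τ')
  arrD   : ∀ {δ δ' τ τ'} → δ' ≤D δ → τ ≤T τ' → δ ⟶ τ ≤D δ' ⟶ τ'

data _≤S_ where
  reflS  : ∀ {φ} → φ ≤S φ
  transS : ∀ {φ ψ χ} → φ ≤S ψ → ψ ≤S χ → φ ≤S χ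
  topS   : ∀ {φ} → φ ≤S ωS
  ∧lS    : ∀ {φ ψ} → φ ∧S ψ ≤S φ
  ∧rS    : ∀ {φ ψ} → φ ∧S ψ ≤S ψ
  dupS   : ∀ {φ} → φ ≤S φ ∧S φ
  monS   : ∀ {φ φ' ψ ψ'} → φ ≤S φ' → ψ ≤S ψ' → φ ∧S ψ ≤S φ' ∧S ψ'
  loc∧   : ∀ {ℓ δ δ'} → ⟨ ℓ ∶ δ ⟩ ∧S ⟨ ℓ ∶ δ' ⟩ ≤S ⟨ ℓ ∶ δ ∧D δ' ⟩
  locS   : ∀ {ℓ δ δ'} → δ ≤D δ' → ⟨ ℓ ∶ δ ⟩ ≤S ⟨ ℓ ∶ δ' ⟩

data _≤C_ where
  reflC  : ∀ {φ} → φ ≤C φ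
  transC : ∀ {φ ψ χ} → φ ≤C ψ → ψ ≤C χ → φ ≤C χ
  topC   : ∀ {φ} → φ ≤C ωC
  ∧lC    : ∀ {φ ψ} → φ ∧C ψ ≤C φ
  ∧rC    : ∀ {φ ψ} → φ ∧C ψ ≤C ψ
  dupC   : ∀ {φ} → φ ≤C φ ∧C φ
  monC   : ∀ {φ φ' ψ ψ'} → φ ≤C φ' → ψ ≤C ψ' → φ ∧C ψ ≤C φ' ∧C ψ'
  ωprod  : ωC ≤C ωD ⊗ ωS
  prod∧  : ∀ {δ δ' σ σ'} → (δ ⊗ σ) ∧C (δ' ⊗ σ') ≤C (δ ∧D δ') ⊗ (σ ∧S σ')
  prodC  : ∀ {δ δ' σ σ'} → δ ≤D δ' → σ ≤S σ' → δ ⊗ σ ≤C δ' ⊗ σ'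

data _≤T_ where
  reflT  : ∀ {φ} → φ ≤T φ
  transT : ∀ {φ ψ χ} → φ ≤T ψ → ψ ≤T χ → φ ≤T χ
  topT   : ∀ {φ} → φ ≤T ωT
  ∧lT    : ∀ {φ ψ} → φ ∧T ψ ≤T φ
  ∧rT    : ∀ {φ ψ} → φ ∧T ψ ≤T ψ
  dupT   : ∀ {φ} → φ ≤T φ ∧T φ
  monT   : ∀ {φ φ' ψ ψ'} → φ ≤T φ' → ψ ≤T ψ' → φ ∧T ψ ≤T φ' ∧T ψ'
  ωfun   : ωT ≤T ωS ⇒ ωC
  fun∧   : ∀ {σ κ κ'} → (σ ⇒ κ) ∧T (σ ⇒ κ') ≤T σ ⇒ (κ ∧C κ')
  funT   : ∀ {σ σ' κ κ'} → σ' ≤S σ → κ ≤C κ' → σ ⇒ κ ≤T σ' ⇒ κ'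

_≃S_ : STy → STy → Set
σ ≃S σ' = (σ ≤S σ') × (σ' ≤S σ)

data _∈dom_ : Loc → STy → Set where
  here  : ∀ {ℓ δ} → ℓ ∈dom ⟨ ℓ ∶ δ ⟩
  left  : ∀ {ℓ σ σ'} → ℓ ∈dom σ → ℓ ∈dom (σ ∧S σ')
  right : ∀ {ℓ σ σ'} → ℓ ∈dom σ' → ℓ ∈dom (σ ∧S σ')

_∉dom_ : Loc → STy → Set
ℓ ∉dom σ = ¬ (ℓ ∈dom σ)

-- Contexts: de Bruijn, Γ , x:δ is δ ∷ Γ.

Ctx : Set
Ctx = List VTy

data _∋_∶_ : Ctx → ℕ → VTy → Set where
  here  : ∀ {Γ δ} → (δ ∷ Γ) ∋ zero ∶ δ
  there : ∀ {Γ n δ δ'} → Γ ∋ n ∶ δ → (δ' ∷ Γ) ∋ suc n ∶ δ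

infix 3 _⊢V_∶_ _⊢M_∶_ _⊢S_∶_ _⊢U_∶_

data _⊢V_∶_ : Ctx → Val → VTy → Set
data _⊢M_∶_ : Ctx → Comp → TTy → Set

data _⊢V_∶_ where
  ωV   : ∀ {Γ V} → Γ ⊢V V ∶ ωD
  ∧V   : ∀ {Γ V δ δ'} → Γ ⊢V V ∶ δ → Γ ⊢V V ∶ δ' → Γ ⊢V V ∶ δ ∧D δ'
  ≤V   : ∀ {Γ V δ δ'} → Γ ⊢V V ∶ δ → δ ≤D δ' → Γ ⊢V V ∶ δ'
  varV : ∀ {Γ x δ} → Γ ∋ x ∶ δ → Γ ⊢V var x ∶ δ
  lamV : ∀ {Γ M δ τ} → (δ ∷ Γ) ⊢M M ∶ τ → Γ ⊢V lam M ∶ δ ⟶ τ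

data _⊢M_∶_ where
  ωM   : ∀ {Γ M} → Γ ⊢M M ∶ ωT
  ∧M   : ∀ {Γ M τ τ'} → Γ ⊢M M ∶ τ → Γ ⊢M M ∶ τ' → Γ ⊢M M ∶ τ ∧T τ'
  ≤M   : ∀ {Γ M τ τ'} → Γ ⊢M M ∶ τ → τ ≤T τ' → Γ ⊢M M ∶ τ'
  retM : ∀ {Γ V δ σ} → Γ ⊢V V ∶ δ → Γ ⊢M ret V ∶ σ ⇒ δ ⊗ σ
  bindM : ∀ {Γ M V σ δ' σ' δ'' σ''} →
          Γ ⊢M M ∶ σ ⇒ δ' ⊗ σ' →
          Γ ⊢V V ∶ δ' ⟶ (σ' ⇒ δ'' ⊗ σ'') →
          Γ ⊢M M ⋆ V ∶ σ ⇒ δ'' ⊗ σ''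
  getM : ∀ {Γ ℓ M δ σ κ} → (δ ∷ Γ) ⊢M M ∶ σ ⇒ κ →
         Γ ⊢M get ℓ M ∶ (⟨ ℓ ∶ δ ⟩ ∧S σ) ⇒ κ
  setM : ∀ {Γ ℓ V M δ σ κ} → Γ ⊢V V ∶ δ →
         Γ ⊢M M ∶ (⟨ ℓ ∶ δ ⟩ ∧S σ) ⇒ κ → ℓ ∉dom σ →
         Γ ⊢M set ℓ V M ∶ σ ⇒ κ

data _⊢S_∶_ : Ctx → Store → STy → Set
data _⊢U_∶_ : Ctx → Lkp → VTy → Set

data _⊢S_∶_ where
  ωS'  : ∀ {Γ s} → Γ ⊢S s ∶ ωS
  ∧S'  : ∀ {Γ s σ σ'} → Γ ⊢S s ∶ σ → Γ ⊢S s ∶ σ' → Γ ⊢S s ∶ σ ∧S σ'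
  ≤S'  : ∀ {Γ s σ σ'} → Γ ⊢S s ∶ σ → σ ≤S σ' → Γ ⊢S s ∶ σ'
  upd₁ : ∀ {Γ ℓ u s δ} → Γ ⊢U u ∶ δ → Γ ⊢S upd ℓ u s ∶ ⟨ ℓ ∶ δ ⟩
  upd₂ : ∀ {Γ ℓ ℓ' u s δ} → Γ ⊢S s ∶ ⟨ ℓ' ∶ δ ⟩ → ¬ (ℓ ≡ ℓ') →
         Γ ⊢S upd ℓ u s ∶ ⟨ ℓ' ∶ δ ⟩

data _⊢U_∶_ where
  ωU   : ∀ {Γ u} → Γ ⊢U u ∶ ωD
  ∧U   : ∀ {Γ u δ δ'} → Γ ⊢U u ∶ δ → Γ ⊢U u ∶ δ' → Γ ⊢U u ∶ δ ∧D δ'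
  ≤U   : ∀ {Γ u δ δ'} → Γ ⊢U u ∶ δ → δ ≤D δ' → Γ ⊢U u ∶ δ'
  valU : ∀ {Γ V δ} → Γ ⊢V V ∶ δ → Γ ⊢U val V ∶ δ
  lkpU : ∀ {Γ ℓ s δ} → Γ ⊢S s ∶ ⟨ ℓ ∶ δ ⟩ → Γ ⊢U lkp ℓ s ∶ δ

{-# OPTIONS --safe #-}
module Submission where

-- Typing derivations of upd ℓ u s are inverted through a predicate on store
-- types that reads an atom ⟨ ℓ' ∶ δ ⟩ as "u has type δ" when ℓ' = ℓ and as
-- "s has type ⟨ ℓ' ∶ δ ⟩" otherwise, and distributes over ∧S and ωS. Every
-- typing of upd ℓ u s satisfies it and it is closed under subtyping, so it
-- survives the intersection and subsumption rules; at a type avoiding ℓ it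
-- only mentions s, which gives (a), and below ⟨ ℓ ∶ δ ⟩ it types u, which
-- gives (b).

open import Defs
open import Data.Empty using (⊥-elim)
open import Data.Product using (_×_; _,_; proj₁)
open import Data.Unit using (⊤; tt)
open import Relation.Nullary using (¬_)
open import Relation.Binary.PropositionalEquality using (_≡_; refl; sym)

∉dom-∧ˡ : ∀ {ℓ σ σ'} → ℓ ∉dom (σ ∧S σ') → ℓ ∉dom σ
∉dom-∧ˡ ℓ∉ ℓ∈ = ℓ∉ (left ℓ∈)

∉dom-∧ʳ : ∀ {ℓ σ σ'} → ℓ ∉dom (σ ∧S σ') → ℓ ∉dom σ'
∉dom-∧ʳ ℓ∉ ℓ∈ = ℓ∉ (right ℓ∈)

∉dom-⟨⟩ : ∀ {ℓ ℓ' δ} → ℓ ∉dom ⟨ ℓ' ∶ δ ⟩ → ¬ ℓ' ≡ ℓ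
∉dom-⟨⟩ ℓ∉ refl = ℓ∉ here

UpdSat : Ctx → Loc → Lkp → Store → STy → Set
UpdSat Γ ℓ u s ⟨ ℓ' ∶ δ ⟩ = (ℓ' ≡ ℓ → Γ ⊢U u ∶ δ) × (¬ ℓ' ≡ ℓ → Γ ⊢S s ∶ ⟨ ℓ' ∶ δ ⟩)
UpdSat Γ ℓ u s (σ ∧S σ')  = UpdSat Γ ℓ u s σ × UpdSat Γ ℓ u s σ'
UpdSat Γ ℓ u s ωS         = ⊤

module _ {Γ : Ctx} {ℓ : Loc} {u : Lkp} {s : Store} where

  updSat-mono : ∀ {σ σ'} → σ ≤S σ' → UpdSat Γ ℓ u s σ → UpdSat Γ ℓ u s σ'
  updSat-mono reflS           sat           = sat
  updSat-mono (transS σ≤ ≤σ') sat           = updSat-mono ≤σ' (updSat-mono σ≤ sat)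
  updSat-mono topS            _             = tt
  updSat-mono ∧lS             (sat , _)     = sat
  updSat-mono ∧rS             (_ , sat)     = sat
  updSat-mono dupS            sat           = sat , sat
  updSat-mono (monS ≤₁ ≤₂)    (sat₁ , sat₂) = updSat-mono ≤₁ sat₁ , updSat-mono ≤₂ sat₂
  updSat-mono loc∧ ((head₁ , tail₁) , (head₂ , tail₂)) =
    (λ eq → ∧U (head₁ eq) (head₂ eq)) , (λ neq → ≤S' (∧S' (tail₁ neq) (tail₂ neq)) loc∧)
  updSat-mono (locS δ≤) (head , tail) =
    (λ eq → ≤U (head eq) δ≤) , (λ neq → ≤S' (tail neq) (locS δ≤))

  upd-generation : ∀ {σ} → Γ ⊢S upd ℓ u s ∶ σ → UpdSat Γ ℓ u s σ
  upd-generation ωS'            = tt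
  upd-generation (∧S' ⊢₁ ⊢₂)    = upd-generation ⊢₁ , upd-generation ⊢₂
  upd-generation (≤S' ⊢σ σ≤)    = updSat-mono σ≤ (upd-generation ⊢σ)
  upd-generation (upd₁ ⊢u)      = (λ _ → ⊢u) , (λ neq → ⊥-elim (neq refl))
  upd-generation (upd₂ ⊢s neq)  = (λ eq → ⊥-elim (neq (sym eq))) , (λ _ → ⊢s)

  updSat⇒tail : ∀ σ → ℓ ∉dom σ → UpdSat Γ ℓ u s σ → Γ ⊢S s ∶ σ
  updSat⇒tail ⟨ ℓ' ∶ δ ⟩ ℓ∉ (_ , tail) = tail (∉dom-⟨⟩ ℓ∉)
  updSat⇒tail (σ ∧S σ')  ℓ∉ (sat , sat') =
    ∧S' (updSat⇒tail σ (∉dom-∧ˡ ℓ∉) sat) (updSat⇒tail σ' (∉dom-∧ʳ ℓ∉) sat')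
  updSat⇒tail ωS         _  _ = ωS'

  upd-weaken : ∀ σ → ℓ ∉dom σ → Γ ⊢S s ∶ σ → Γ ⊢S upd ℓ u s ∶ σ
  upd-weaken ⟨ ℓ' ∶ δ ⟩ ℓ∉ ⊢s = upd₂ ⊢s (λ { refl → ℓ∉ here })
  upd-weaken (σ ∧S σ')  ℓ∉ ⊢s =
    ∧S' (upd-weaken σ (∉dom-∧ˡ ℓ∉) (≤S' ⊢s ∧lS)) (upd-weaken σ' (∉dom-∧ʳ ℓ∉) (≤S' ⊢s ∧rS))
  upd-weaken ωS         _  _  = ωS'

  upd-strengthen : ∀ σ → ℓ ∉dom σ → Γ ⊢S upd ℓ u s ∶ σ → Γ ⊢S s ∶ σ
  upd-strengthen σ ℓ∉ ⊢upd = updSat⇒tail σ ℓ∉ (upd-generation ⊢upd)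

  upd-head : ∀ {σ δ} → Γ ⊢S upd ℓ u s ∶ σ → σ ≤S ⟨ ℓ ∶ δ ⟩ → Γ ⊢U u ∶ δ
  upd-head ⊢upd σ≤ = proj₁ (updSat-mono σ≤ (upd-generation ⊢upd)) refl

val-inversion : ∀ {Γ V δ} → Γ ⊢U val V ∶ δ → Γ ⊢V V ∶ δ
val-inversion ωU           = ωV
val-inversion (∧U ⊢₁ ⊢₂)   = ∧V (val-inversion ⊢₁) (val-inversion ⊢₂)
val-inversion (≤U ⊢δ δ≤)   = ≤V (val-inversion ⊢δ) δ≤
val-inversion (valU ⊢V)    = ⊢V

mainTheorem16 :
    (∀ (Γ : Ctx) (s : Store) (V : Val) (ℓ : Loc) (σ : STy) →
       ℓ ∉dom σ →
       (Γ ⊢S s ∶ σ → Γ ⊢S upd ℓ (val V) s ∶ σ) × (Γ ⊢S upd ℓ (val V) s ∶ σ → Γ ⊢S s ∶ σ))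
    ×
    (∀ (Γ : Ctx) (s : Store) (V : Val) (ℓ : Loc) (σ : STy) (δ : VTy) →
       Γ ⊢S upd ℓ (val V) s ∶ σ →
       σ ≤S ⟨ ℓ ∶ δ ⟩ →
       ¬ (⟨ ℓ ∶ δ ⟩ ≃S ωS) →
       Γ ⊢V V ∶ δ)
mainTheorem16 = part-a , part-b
  where
  part-a : ∀ Γ s V ℓ σ → ℓ ∉dom σ →
           (Γ ⊢S s ∶ σ → Γ ⊢S upd ℓ (val V) s ∶ σ) × (Γ ⊢S upd ℓ (val V) s ∶ σ → Γ ⊢S s ∶ σ)
  part-a _ _ _ _ σ ℓ∉ = upd-weaken σ ℓ∉ , upd-strengthen σ ℓ∉

  -- The hypothesis ¬ (⟨ ℓ ∶ δ ⟩ ≃S ωS) is deliberately unused: upd-head types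
  -- the stored lookup term at δ without it.
  part-b : ∀ Γ s V ℓ σ δ → Γ ⊢S upd ℓ (val V) s ∶ σ → σ ≤S ⟨ ℓ ∶ δ ⟩ →
           ¬ (⟨ ℓ ∶ δ ⟩ ≃S ωS) → Γ ⊢V V ∶ δ
  part-b _ _ _ _ _ _ ⊢upd σ≤ _ = val-inversion (upd-head ⊢upd σ≤)
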